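{- Let $C$ be a cycle with $|V(C)| \geq 6$ and let $p := \lfloor |V(C)|/3 \rfloor$. If $S,T \subseteq V(C)$ with $|S| \geq p+1$ and $|T| \geq 2p+2$, then there exist vertex-disjoint paths $P,Q$ contained in $C$ such that both end vertices of $P$ are in $S$, both end vertices of $Q$ are in $T$, and $|V(P)|,|V(Q)| \geq p+1$.
   Context: A path in a cycle $C$ means a subpath of $C$ (a set of consecutive vertices of $C$ together with the edges of $C$ between them). -}

module Defs where

open import Data.Nat using (ℕ; zero; suc; _+_; _∸_; _≤_; _<_; NonZero)
open import Data.Nat.DivMod using (_%_; m%n<n)
open import Data.Fin using (Fin; toℕ; fromℕ<)
open import Data.Fin.Subset using (Subset; _∈_)
open import Data.Product using (_×_)
open import Relation.Binary.PropositionalEquality using (_≢_)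

-- The cycle C_n: vertex set Fin n, vertex i adjacent to i+1 (mod n).
-- Its j-th successor of vertex s: (s + j) mod n.
shift : (n : ℕ) .{{_ : NonZero n}} → Fin n → ℕ → Fin n
shift n s j = fromℕ< (m%n<n (toℕ s + j) n)

-- A path in C_n (subpath of the cycle): `len` consecutive vertices
-- start, start+1, ..., start+len-1 (mod n), with 1 ≤ len ≤ n,
-- so its vertices are distinct and |V(P)| = len.
record CPath (n : ℕ) : Set where
  constructor cpath
  field
    start : Fin n
    len   : ℕ
    len≥1 : 1 ≤ len
    len≤n : len ≤ n
open CPath public

-- the j-th vertex of the path (meaningful for j < len)
vertex : {n : ℕ} .{{_ : NonZero n}} → CPath n → ℕ → Fin n
vertex {n} P j = shift n (start P) j

end₁ end₂ : {n : ℕ} .{{_ : NonZero n}} → CPath n → Fin n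
end₁ P = vertex P 0
end₂ P = vertex P (len P ∸ 1)

Disjoint : {n : ℕ} .{{_ : NonZero n}} → CPath n → CPath n → Set
Disjoint P Q = ∀ i j → i < len P → j < len Q → vertex P i ≢ vertex Q j

EndsIn : {n : ℕ} .{{_ : NonZero n}} → CPath n → Subset n → Set
EndsIn P S = (end₁ P ∈ S) × (end₂ P ∈ S)

module Submission where

-- Call an arc of at least p + 1 vertices with both ends in S a split if more than p vertices of T
-- lie off it; among those, the first and last T-vertex are far enough apart to bound Q.
-- Two S-vertices at distance exactly p give a split, since the arc between them holds at most
-- p + 1 of the 2p + 2 vertices of T. So do three S-vertices x, y, z met in this order with both
-- arcs x → y and y → z of length at least p: the T-vertices off these two arcs cover T except
-- possibly y, so one of the two arcs leaves more than p of them. Such a pair or triple always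
-- exists when 3p ≤ n and |S| > p: go from s ∈ S to the first S-vertex s + p + u at distance at
-- least p. If u = 0 we have a pair. If the gap u is long, S is squeezed into 2p consecutive
-- vertices and pigeonholes into a pair at distance p; if it is short, a vertex of S in one of
-- three short windows completes a triple, and otherwise S is too small.

open import Defs
open import Data.Bool using (Bool; true; false)
open import Data.Empty using (⊥; ⊥-elim)
open import Data.Fin using (Fin; toℕ; fromℕ<) renaming (zero to fzero; suc to fsuc)
open import Data.Fin.Properties using (toℕ-fromℕ<)
open import Data.Fin.Subset using (Subset; ∣_∣; _∈_)
open import Data.Nat
open import Data.Nat.DivMod
open import Data.Nat.Properties
open import Data.Nat.Tactic.RingSolver using (solve-∀)
open import Data.Product using (∃; ∃₂; _×_; _,_)
open import Data.Sum using (_⊎_; inj₁; inj₂; [_,_]′)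
open import Data.Vec using (Vec; []; _∷_; lookup)
open import Data.Vec.Properties using (lookup⇒[]=)
open import Relation.Binary.PropositionalEquality
open import Relation.Nullary using (Dec; yes; no)

bit : Bool → ℕ
bit true  = 1
bit false = 0

bit≤1 : ∀ b → bit b ≤ 1
bit≤1 true  = ≤-refl
bit≤1 false = z≤n

count : (ℕ → Bool) → ℕ → ℕ → ℕ
count f c zero    = 0
count f c (suc w) = bit (f c) + count f (suc c) w

Periodic : ℕ → (ℕ → Bool) → Set
Periodic n f = ∀ k → f (k + n) ≡ f k

module _ (f : ℕ → Bool) where

  count-+ : ∀ c v w → count f c (v + w) ≡ count f c v + count f (c + v) w
  count-+ c zero    w = cong (λ x → count f x w) (sym (+-identityʳ c))
  count-+ c (suc v) w = begin
    bit (f c) + count f (suc c) (v + w)                          ≡⟨ cong (bit (f c) +_) (count-+ (suc c) v w) ⟩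
    bit (f c) + (count f (suc c) v + count f (suc c + v) w)      ≡⟨ sym (+-assoc (bit (f c)) _ _) ⟩
    bit (f c) + count f (suc c) v + count f (suc c + v) w        ≡⟨ cong (λ x → bit (f c) + count f (suc c) v + count f x w) (sym (+-suc c v)) ⟩
    bit (f c) + count f (suc c) v + count f (c + suc v) w        ∎
    where open ≡-Reasoning

  count≤ : ∀ c w → count f c w ≤ w
  count≤ c zero    = z≤n
  count≤ c (suc w) = +-mono-≤ (bit≤1 (f c)) (count≤ (suc c) w)

  count-periodic : ∀ {n} → Periodic n f → ∀ c w → count f (c + n) w ≡ count f c w
  count-periodic per c zero    = refl
  count-periodic per c (suc w) = cong₂ _+_ (cong bit (per c)) (count-periodic per (suc c) w)

  count-rotate : ∀ {n} → Periodic n f → ∀ c → count f c n ≡ count f 0 n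
  count-rotate         per zero    = refl
  count-rotate {n = n} per (suc c) = trans (+-cancelˡ-≡ (bit (f c)) _ _ step) (count-rotate per c)
    where
    open ≡-Reasoning
    step : bit (f c) + count f (suc c) n ≡ bit (f c) + count f c n
    step = begin
      count f c (suc n)                          ≡⟨ cong (count f c) (+-comm 1 n) ⟩
      count f c (n + 1)                          ≡⟨ count-+ c n 1 ⟩
      count f c n + (bit (f (c + n)) + 0)        ≡⟨ cong (λ b → count f c n + b) (trans (+-identityʳ _) (cong bit (per c))) ⟩
      count f c n + bit (f c)                    ≡⟨ +-comm (count f c n) _ ⟩
      bit (f c) + count f c n                    ∎

  count-cong : ∀ (g : ℕ → Bool) c w → (∀ i → i < w → f (c + i) ≡ g (c + i)) → count f c w ≡ count g c w
  count-cong g c zero    eq = refl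
  count-cong g c (suc w) eq = cong₂ _+_
    (cong bit (subst (λ x → f x ≡ g x) (+-identityʳ c) (eq 0 z<s)))
    (count-cong g (suc c) w (λ i i<w → subst (λ x → f x ≡ g x) (+-suc c i) (eq (suc i) (s≤s i<w))))

  count-suc : ∀ c w → count (λ k → f (suc k)) c w ≡ count f (suc c) w
  count-suc c zero    = refl
  count-suc c (suc w) = cong (bit (f (suc c)) +_) (count-suc (suc c) w)

  private
    here : ∀ {c b} → f c ≡ b → f (c + 0) ≡ b
    here {c} = trans (cong f (+-identityʳ c))

    there : ∀ {c u b} → f (suc c + u) ≡ b → f (c + suc u) ≡ b
    there {c} {u} = trans (cong f (+-suc c u))

  first-true-or-none : ∀ c w → (∃ λ u → u < w × f (c + u) ≡ true × count f c u ≡ 0) ⊎ count f c w ≡ 0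
  first-true-or-none c zero = inj₂ refl
  first-true-or-none c (suc w) with f c in eq
  ... | true = inj₁ (0 , z<s , here eq , refl)
  ... | false with first-true-or-none (suc c) w
  ...   | inj₁ (u , u<w , fu , none) = inj₁ (suc u , s≤s u<w , there fu ,
            subst (λ b → bit b + count f (suc c) u ≡ 0) (sym eq) none)
  ...   | inj₂ none = inj₂ none

  last-true : ∀ c w m → m ≤ count f c w → 1 ≤ m → ∃ λ v → v < w × f (c + v) ≡ true × m ≤ suc v
  last-true c zero    m h 1≤m = ⊥-elim (<⇒≱ 1≤m h)
  last-true c (suc w) m h 1≤m with count f (suc c) w in eq
  ... | suc k with last-true (suc c) w (suc k) (≤-reflexive (sym eq)) (s≤s z≤n)
  ...   | v , v<w , fv , k<v = suc v , s≤s v<w , there fv , ≤-trans h (+-mono-≤ (bit≤1 (f c)) k<v)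
  last-true c (suc w) m h 1≤m | zero with f c in eq
  ... | true  = 0 , z<s , here eq , h
  ... | false = ⊥-elim (<⇒≱ 1≤m h)

  trues-apart : ∀ k c w → suc k ≤ count f c w →
    ∃₂ λ u v → u + k ≤ v × v < w × f (c + u) ≡ true × f (c + v) ≡ true
  trues-apart k c (suc w) h with f c in eq
  trues-apart zero c (suc w) h | true = 0 , 0 , z≤n , z<s , here eq , here eq
  trues-apart (suc k) c (suc w) (s≤s h) | true with last-true (suc c) w (suc k) h (s≤s z≤n)
  ... | v , v<w , fv , k<v = 0 , suc v , k<v , s≤s v<w , here eq , there fv
  trues-apart k c (suc w) h | false with trues-apart k (suc c) w h
  ... | u , v , u+k≤v , v<w , fu , fv = suc u , suc v , s≤s u+k≤v , s≤s v<w , there fu , there fv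

  shared-true-or-count≤ : ∀ d c w →
    (∃ λ i → i < w × f (c + i) ≡ true × f (c + d + i) ≡ true) ⊎ (count f c w + count f (c + d) w ≤ w)
  shared-true-or-count≤ d c zero = inj₂ z≤n
  shared-true-or-count≤ d c (suc w) with shared-true-or-count≤ d (suc c) w
  ... | inj₁ (i , i<w , fi , fdi) = inj₁ (suc i , s≤s i<w , there fi , there fdi)
  ... | inj₂ le with f c in e₁ | f (c + d) in e₂
  ...   | true  | true  = inj₁ (0 , z<s , here e₁ , here e₂)
  ...   | true  | false = inj₂ (s≤s le)
  ...   | false | true  = inj₂ (subst (_≤ suc w) (sym (+-suc _ _)) (s≤s le))
  ...   | false | false = inj₂ (m≤n⇒m≤1+n le)

  count-empty-ends : ∀ c a e b → count f c a ≡ 0 → count f (c + e) b ≡ 0 → count f c (e + b) ≤ e ∸ a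
  count-empty-ends c a e b none-a none-b with a ≤? e
  ... | yes a≤e = begin
    count f c (e + b)                          ≡⟨ count-+ c e b ⟩
    count f c e + count f (c + e) b            ≡⟨ cong (count f c e +_) none-b ⟩
    count f c e + 0                            ≡⟨ +-identityʳ _ ⟩
    count f c e                                ≡⟨ cong (count f c) (sym (m+[n∸m]≡n a≤e)) ⟩
    count f c (a + (e ∸ a))                    ≡⟨ count-+ c a (e ∸ a) ⟩
    count f c a + count f (c + a) (e ∸ a)      ≡⟨ cong (_+ count f (c + a) (e ∸ a)) none-a ⟩
    count f (c + a) (e ∸ a)                    ≤⟨ count≤ (c + a) (e ∸ a) ⟩
    e ∸ a                                      ∎
    where open ≤-Reasoning
  ... | no a≰e = ≤-trans (begin
    count f c (e + b)                          ≡⟨ count-+ c e b ⟩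
    count f c e + count f (c + e) b            ≡⟨ cong (count f c e +_) none-b ⟩
    count f c e + 0                            ≡⟨ +-identityʳ _ ⟩
    count f c e                                ≤⟨ m≤m+n _ _ ⟩
    count f c e + count f (c + e) (a ∸ e)      ≡⟨ count-+ c e (a ∸ e) ⟨
    count f c (e + (a ∸ e))                    ≡⟨ cong (count f c) (m+[n∸m]≡n (<⇒≤ (≰⇒> a≰e))) ⟩
    count f c a                                ≡⟨ none-a ⟩
    0                                          ∎) z≤n
    where open ≤-Reasoning

∸+∸≤ : ∀ m u b → m ≤ u + b → m ∸ u + (m ∸ b) ≤ m
∸+∸≤ m u b m≤u+b with u ≤? m
... | yes u≤m = begin
  m ∸ u + (m ∸ b)      ≤⟨ +-monoʳ-≤ (m ∸ u) (m≤n+o⇒m∸n≤o m b (subst (m ≤_) (+-comm u b) m≤u+b)) ⟩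
  m ∸ u + u            ≡⟨ m∸n+n≡m u≤m ⟩
  m                    ∎
  where open ≤-Reasoning
... | no u≰m = begin
  m ∸ u + (m ∸ b)      ≡⟨ cong (_+ (m ∸ b)) (m≤n⇒m∸n≡0 (<⇒≤ (≰⇒> u≰m))) ⟩
  m ∸ b                ≤⟨ m∸n≤m m b ⟩
  m                    ∎
  where open ≤-Reasoning

at : ∀ {m} → Vec Bool m → ℕ → Bool
at []       k       = false
at (b ∷ bs) zero    = b
at (b ∷ bs) (suc k) = at bs k

at-lookup : ∀ {m} (X : Vec Bool m) (i : Fin m) → at X (toℕ i) ≡ lookup X i
at-lookup (b ∷ X) fzero    = refl
at-lookup (b ∷ X) (fsuc i) = at-lookup X i

∣∣≡count-at : ∀ {m} (X : Subset m) → ∣ X ∣ ≡ count (at X) 0 m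
∣∣≡count-at []                  = refl
∣∣≡count-at {suc m} (true ∷ X)  = cong suc (trans (∣∣≡count-at X) (count-suc (at (true ∷ X)) 0 m))
∣∣≡count-at {suc m} (false ∷ X) = trans (∣∣≡count-at X) (count-suc (at (false ∷ X)) 0 m)

module _ (n : ℕ) .{{_ : NonZero n}} where

  -- Vertices of the cycle are addressed by arbitrary naturals, read modulo n.
  member : Subset n → ℕ → Bool
  member X k = at X (k % n)

  member-periodic : ∀ X → Periodic n (member X)
  member-periodic X k = cong (at X) ([m+n]%n≡m%n k n)

  ∣∣≡count : ∀ X c → ∣ X ∣ ≡ count (member X) c n
  ∣∣≡count X c = begin
    ∣ X ∣                      ≡⟨ ∣∣≡count-at X ⟩
    count (at X) 0 n           ≡⟨ count-cong (at X) (member X) 0 n (λ i i<n → cong (at X) (sym (m<n⇒m%n≡m i<n))) ⟩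
    count (member X) 0 n       ≡⟨ count-rotate (member X) (member-periodic X) c ⟨
    count (member X) c n       ∎
    where open ≡-Reasoning

  pos : ℕ → Fin n
  pos k = fromℕ< (m%n<n k n)

  [m+k]%n≡[m%n+k]%n : ∀ m k → (m + k) % n ≡ (m % n + k) % n
  [m+k]%n≡[m%n+k]%n m k = begin
    (m + k) % n                      ≡⟨ %-distribˡ-+ m k n ⟩
    (m % n + k % n) % n              ≡⟨ cong (λ x → (x + k % n) % n) (m%n%n≡m%n m n) ⟨
    (m % n % n + k % n) % n          ≡⟨ %-distribˡ-+ (m % n) k n ⟨
    (m % n + k) % n                  ∎
    where open ≡-Reasoning

  toℕ-shift-pos : ∀ a j → toℕ (shift n (pos a) j) ≡ (a + j) % n
  toℕ-shift-pos a j = begin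
    toℕ (shift n (pos a) j)    ≡⟨ toℕ-fromℕ< (m%n<n (toℕ (pos a) + j) n) ⟩
    (toℕ (pos a) + j) % n      ≡⟨ cong (λ x → (x + j) % n) (toℕ-fromℕ< (m%n<n a n)) ⟩
    (a % n + j) % n            ≡⟨ [m+k]%n≡[m%n+k]%n a j ⟨
    (a + j) % n                ∎
    where open ≡-Reasoning

  member⇒∈ : ∀ X a j → member X (a + j) ≡ true → shift n (pos a) j ∈ X
  member⇒∈ X a j a+j∈X = lookup⇒[]= _ X (begin
    lookup X (shift n (pos a) j)       ≡⟨ at-lookup X (shift n (pos a) j) ⟨
    at X (toℕ (shift n (pos a) j))     ≡⟨ cong (at X) (toℕ-shift-pos a j) ⟩
    member X (a + j)                   ≡⟨ a+j∈X ⟩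
    true                               ∎)
    where open ≡-Reasoning

  %-distinct-within-n : ∀ x k → 0 < k → k < n → x % n ≢ (x + k) % n
  %-distinct-within-n x k 0<k k<n eq with x % n + k <? n
  ... | yes r+k<n = <-irrefl refl (begin-strict
    x % n                  <⟨ m<m+n (x % n) 0<k ⟩
    x % n + k              ≡⟨ m<n⇒m%n≡m r+k<n ⟨
    (x % n + k) % n        ≡⟨ [m+k]%n≡[m%n+k]%n x k ⟨
    (x + k) % n            ≡⟨ eq ⟨
    x % n                  ∎)
    where open ≤-Reasoning
  ... | no r+k≮n = <-irrefl refl (begin-strict
    x % n + k ∸ n          <⟨ wrapped<r ⟩
    x % n                  ≡⟨ eq ⟩
    (x + k) % n            ≡⟨ [m+k]%n≡[m%n+k]%n x k ⟩
    (x % n + k) % n        ≡⟨ m≤n⇒[n∸m]%m≡n%m (≮⇒≥ r+k≮n) ⟨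
    (x % n + k ∸ n) % n    ≡⟨ m<n⇒m%n≡m (<-≤-trans wrapped<r (m%n≤n x n)) ⟩
    x % n + k ∸ n          ∎)
    where
    open ≤-Reasoning
    wrapped<r : x % n + k ∸ n < x % n
    wrapped<r = begin-strict
      x % n + k ∸ n        <⟨ ∸-monoˡ-< (+-monoʳ-< (x % n) k<n) (≮⇒≥ r+k≮n) ⟩
      x % n + n ∸ n        ≡⟨ m+n∸n≡m (x % n) n ⟩
      x % n                ∎

  arcs-disjoint : ∀ a ℓ u m {1≤ℓ ℓ≤n 1≤m m≤n} → ℓ + u + m ≤ n →
    Disjoint (cpath (pos a) ℓ 1≤ℓ ℓ≤n) (cpath (pos (a + ℓ + u)) m 1≤m m≤n)
  arcs-disjoint a ℓ u m room i j i<ℓ j<m same =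
    %-distinct-within-n (a + i) k 0<k k<n (begin
      (a + i) % n                              ≡⟨ toℕ-shift-pos a i ⟨
      toℕ (shift n (pos a) i)                  ≡⟨ cong toℕ same ⟩
      toℕ (shift n (pos (a + ℓ + u)) j)        ≡⟨ toℕ-shift-pos (a + ℓ + u) j ⟩
      (a + ℓ + u + j) % n                      ≡⟨ cong (λ x → (a + x + u + j) % n) (m+[n∸m]≡n (<⇒≤ i<ℓ)) ⟨
      (a + (i + (ℓ ∸ i)) + u + j) % n          ≡⟨ cong (_% n) (regroup a i (ℓ ∸ i) u j) ⟩
      (a + i + k) % n                          ∎)
    where
    open ≡-Reasoning
    k = ℓ ∸ i + u + j
    regroup : ∀ a i t u j → a + (i + t) + u + j ≡ a + i + (t + u + j)
    regroup = solve-∀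
    0<k : 0 < k
    0<k = ≤-trans (≤-trans (m<n⇒0<n∸m i<ℓ) (m≤m+n _ u)) (m≤m+n _ j)
    k<n : k < n
    k<n = <-≤-trans (+-mono-≤-< (+-monoˡ-≤ u (m∸n≤m ℓ i)) j<m) room

  PathPair : ℕ → Subset n → Subset n → Set
  PathPair p S T = ∃₂ λ (P Q : CPath n) →
    Disjoint P Q × EndsIn P S × EndsIn Q T × suc p ≤ len P × suc p ≤ len Q

  record Split (p : ℕ) (S T : Subset n) : Set where
    constructor split
    field
      a d w    : ℕ
      arcs     : suc d + w ≡ n
      p≤d      : p ≤ d
      a∈S      : member S a ≡ true
      a+d∈S    : member S (a + d) ≡ true
      p<T-rest : p < count (member T) (a + suc d) w

  paths-from-split : ∀ {p S T} → Split p S T → PathPair p S T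
  paths-from-split {p} {S} {T} (split a d w arcs p≤d a∈S a+d∈S p<T-rest)
    with trues-apart (member T) p (a + suc d) w p<T-rest
  ... | u , v , u+p≤v , v<w , c∈T , c+[v∸u]∈T =
    P , Q , arcs-disjoint a (suc d) u (suc (v ∸ u)) {s≤s z≤n} {P-fits} {s≤s z≤n} {Q-fits} room ,
    (member⇒∈ S a 0 (subst (λ x → member S x ≡ true) (sym (+-identityʳ a)) a∈S) , member⇒∈ S a d a+d∈S) ,
    (member⇒∈ T c 0 (subst (λ x → member T x ≡ true) (sym (+-identityʳ c)) c∈T) ,
     member⇒∈ T c (v ∸ u) (subst (λ x → member T x ≡ true) c+[v∸u]≡ c+[v∸u]∈T)) ,
    s≤s p≤d , s≤s p≤v∸u
    where
    open ≤-Reasoning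
    c = a + suc d + u
    u≤v : u ≤ v
    u≤v = ≤-trans (m≤m+n u p) u+p≤v
    c+[v∸u]≡ : a + suc d + v ≡ c + (v ∸ u)
    c+[v∸u]≡ = trans (cong (a + suc d +_) (sym (m+[n∸m]≡n u≤v))) (sym (+-assoc (a + suc d) u (v ∸ u)))
    p≤v∸u : p ≤ v ∸ u
    p≤v∸u = subst (_≤ v ∸ u) (m+n∸m≡n u p) (∸-monoˡ-≤ u u+p≤v)
    w≤n : w ≤ n
    w≤n = subst (w ≤_) arcs (m≤n+m w (suc d))
    room : suc d + u + suc (v ∸ u) ≤ n
    room = begin
      suc d + u + suc (v ∸ u)      ≡⟨ +-assoc (suc d) u _ ⟩
      suc d + (u + suc (v ∸ u))    ≡⟨ cong (suc d +_) (trans (+-suc u _) (cong suc (m+[n∸m]≡n u≤v))) ⟩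
      suc d + suc v                ≤⟨ +-monoʳ-≤ (suc d) v<w ⟩
      suc d + w                    ≡⟨ arcs ⟩
      n                            ∎
    P-fits : suc d ≤ n
    P-fits = subst (suc d ≤_) arcs (m≤m+n (suc d) w)
    Q-fits : suc (v ∸ u) ≤ n
    Q-fits = begin
      suc (v ∸ u)   ≤⟨ s≤s (m∸n≤m v u) ⟩
      suc v         ≤⟨ v<w ⟩
      w             ≤⟨ w≤n ⟩
      n             ∎
    P Q : CPath n
    P = cpath (pos a) (suc d) (s≤s z≤n) P-fits
    Q = cpath (pos c) (suc (v ∸ u)) (s≤s z≤n) Q-fits

module _ (n : ℕ) .{{_ : NonZero n}} (S : Subset n) where

  χ : ℕ → Bool
  χ = member n S

  InS : ℕ → Set
  InS k = χ k ≡ true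

  InS-+n : ∀ {k} → InS k → InS (k + n)
  InS-+n {k} = trans (member-periodic n S k)

  Pair : ℕ → Set
  Pair p = ∃ λ a → InS a × InS (a + p)

  -- S-vertices x, x + e₁ and x + e₁ + e₂, pairwise distinct since 0 < e₁ + e₂ < n.
  Triple : ℕ → Set
  Triple p = ∃ λ x → ∃ λ e₁ → ∃ λ e₂ → p ≤ e₁ × p ≤ e₂ × e₁ + e₂ < n × InS x × InS (x + e₁) × InS (x + e₁ + e₂)

  module _ (p : ℕ) (T : Subset n) (2p+2≤∣T∣ : suc p + suc p ≤ ∣ T ∣) where

    split-from-pair : p < n → Pair p → Split n p S T
    split-from-pair p<n (a , a∈S , a+p∈S) =
      split a p w arcs ≤-refl a∈S a+p∈S (+-cancelˡ-≤ (suc p) (suc p) _ (begin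
        suc p + suc p                                               ≤⟨ 2p+2≤∣T∣ ⟩
        ∣ T ∣                                                       ≡⟨ ∣∣≡count n T a ⟩
        count (member n T) a n                                      ≡⟨ cong (count (member n T) a) arcs ⟨
        count (member n T) a (suc p + w)                            ≡⟨ count-+ (member n T) a (suc p) w ⟩
        count (member n T) a (suc p) + count (member n T) (a + suc p) w
                                                                    ≤⟨ +-monoˡ-≤ _ (count≤ (member n T) a (suc p)) ⟩
        suc p + count (member n T) (a + suc p) w                    ∎))
      where
      open ≤-Reasoning
      w = n ∸ suc p
      arcs : suc p + w ≡ n
      arcs = m+[n∸m]≡n p<n

    -- The T-vertices off the arc from x to x + e₁ and those off the arc from x + e₁ to
    -- x + e₁ + e₂ together cover T, except possibly the vertex x + e₁.
    split-from-triple : Triple p → Split n p S T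
    split-from-triple (x , e₁ , e₂ , p≤e₁ , p≤e₂ , e₁+e₂<n , x∈S , y∈S , z∈S) =
      choose (p <? γ + ζ) (p <? ζ + α)
      where
      f = member n T
      w₀ = n ∸ suc (e₁ + e₂)
      α = count f x e₁
      β = bit (f (x + e₁))
      γ = count f (x + suc e₁) e₂
      ζ = count f (x + e₁ + suc e₂) w₀

      around : suc (e₁ + e₂) + w₀ ≡ n
      around = m+[n∸m]≡n e₁+e₂<n

      arcs₁ : suc e₁ + (e₂ + w₀) ≡ n
      arcs₁ = trans (regroup e₁ e₂ w₀) around
        where
        regroup : ∀ a b c → suc a + (b + c) ≡ suc (a + b) + c
        regroup = solve-∀

      arcs₂ : suc e₂ + (w₀ + e₁) ≡ n
      arcs₂ = trans (regroup e₁ e₂ w₀) around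
        where
        regroup : ∀ a b c → suc b + (c + a) ≡ suc (a + b) + c
        regroup = solve-∀

      rest₁ : count f (x + suc e₁) (e₂ + w₀) ≡ γ + ζ
      rest₁ = trans (count-+ f (x + suc e₁) e₂ w₀) (cong (λ y → γ + count f y w₀) (regroup x e₁ e₂))
        where
        regroup : ∀ a b c → a + suc b + c ≡ a + b + suc c
        regroup = solve-∀

      rest₂ : count f (x + e₁ + suc e₂) (w₀ + e₁) ≡ ζ + α
      rest₂ = begin
        count f (x + e₁ + suc e₂) (w₀ + e₁)               ≡⟨ count-+ f (x + e₁ + suc e₂) w₀ e₁ ⟩
        ζ + count f (x + e₁ + suc e₂ + w₀) e₁             ≡⟨ cong (λ y → ζ + count f y e₁) (regroup x e₁ e₂ w₀) ⟩
        ζ + count f (x + (suc (e₁ + e₂) + w₀)) e₁         ≡⟨ cong (λ y → ζ + count f (x + y) e₁) around ⟩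
        ζ + count f (x + n) e₁                            ≡⟨ cong (ζ +_) (count-periodic f (member-periodic n T) x e₁) ⟩
        ζ + α                                             ∎
        where
        open ≡-Reasoning
        regroup : ∀ a b c d → a + b + suc c + d ≡ a + (suc (b + c) + d)
        regroup = solve-∀

      whole : ∣ T ∣ ≡ α + ((β + γ) + ζ)
      whole = begin
        ∣ T ∣                                         ≡⟨ ∣∣≡count n T x ⟩
        count f x n                                   ≡⟨ cong (count f x) (trans (regroup e₁ e₂ w₀) around) ⟨
        count f x (e₁ + (suc e₂ + w₀))                ≡⟨ count-+ f x e₁ (suc e₂ + w₀) ⟩
        α + count f (x + e₁) (suc e₂ + w₀)            ≡⟨ cong (α +_) (count-+ f (x + e₁) (suc e₂) w₀) ⟩
        α + (count f (x + e₁) (suc e₂) + ζ)           ≡⟨ cong (λ y → α + ((β + count f y e₂) + ζ)) (+-suc x e₁) ⟨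
        α + ((β + γ) + ζ)                             ∎
        where
        open ≡-Reasoning
        regroup : ∀ a b c → a + (suc b + c) ≡ suc (a + b) + c
        regroup = solve-∀

      choose : Dec (p < γ + ζ) → Dec (p < ζ + α) → Split n p S T
      choose (yes p<γ+ζ) _ = split x e₁ (e₂ + w₀) arcs₁ p≤e₁ x∈S y∈S (subst (p <_) (sym rest₁) p<γ+ζ)
      choose (no _) (yes p<ζ+α) = split (x + e₁) e₂ (w₀ + e₁) arcs₂ p≤e₂ y∈S z∈S (subst (p <_) (sym rest₂) p<ζ+α)
      choose (no p≮γ+ζ) (no p≮ζ+α) = ⊥-elim (<-irrefl refl (begin-strict
        suc p + p                         <⟨ +-monoʳ-< (suc p) (n<1+n p) ⟩
        suc p + suc p                     ≤⟨ 2p+2≤∣T∣ ⟩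
        ∣ T ∣                             ≡⟨ whole ⟩
        α + ((β + γ) + ζ)                 ≤⟨ +-monoʳ-≤ α (+-monoˡ-≤ ζ (+-monoˡ-≤ γ (bit≤1 (f (x + e₁))))) ⟩
        α + ((1 + γ) + ζ)                 ≡⟨ regroup α γ ζ ⟩
        suc ((γ + ζ) + α)                 ≤⟨ s≤s (+-mono-≤ (≮⇒≥ p≮γ+ζ) (≤-trans (m≤n+m α ζ) (≮⇒≥ p≮ζ+α))) ⟩
        suc p + p                         ∎))
        where
        open ≤-Reasoning
        regroup : ∀ a g z → a + ((1 + g) + z) ≡ suc ((g + z) + a)
        regroup = solve-∀

  pair-from-crowded-window : ∀ p c → p < count χ c (p + p) → Pair p
  pair-from-crowded-window p c crowded with shared-true-or-count≤ χ p c p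
  ... | inj₁ (i , _ , c+i∈S , c+p+i∈S) = c + i , c+i∈S , subst InS (swap c p i) c+p+i∈S
    where
    swap : ∀ a b c → a + b + c ≡ a + c + b
    swap = solve-∀
  ... | inj₂ sparse = ⊥-elim (<⇒≱ crowded (subst (_≤ p) (sym (count-+ χ c p p)) sparse))

  -- S avoids the u vertices from s + p on, and only k ≤ p follow them before s + n, so S lies in
  -- the 2p vertices ending at s + p - 1.
  pair-from-long-gap : ∀ p s u k → n ≡ p + (u + k) → k ≤ p → count χ (s + p) u ≡ 0 → p < ∣ S ∣ → Pair p
  pair-from-long-gap p s u k n≡ k≤p gap p<∣S∣ = pair-from-crowded-window p c (begin-strict
    p                                                   <⟨ p<∣S∣ ⟩
    ∣ S ∣                                               ≡⟨ ∣∣≡count n S s ⟩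
    count χ s n                                         ≡⟨ cong (count χ s) n≡ ⟩
    count χ s (p + (u + k))                             ≡⟨ count-+ χ s p (u + k) ⟩
    count χ s p + count χ (s + p) (u + k)               ≡⟨ cong (count χ s p +_) (count-+ χ (s + p) u k) ⟩
    count χ s p + (count χ (s + p) u + count χ (s + p + u) k)
                                                        ≡⟨ cong (λ y → count χ s p + (y + count χ (s + p + u) k)) gap ⟩
    count χ s p + count χ (s + p + u) k                 ≤⟨ +-monoʳ-≤ (count χ s p) tail≤ ⟩
    count χ s p + count χ c p                           ≡⟨ +-comm (count χ s p) _ ⟩
    count χ c p + count χ s p                           ≡⟨ cong (count χ c p +_) (count-periodic χ (member-periodic n S) s p) ⟨
    count χ c p + count χ (s + n) p                     ≡⟨ cong (λ y → count χ c p + count χ y p) s+n≡c+p ⟩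
    count χ c p + count χ (c + p) p                     ≡⟨ count-+ χ c p p ⟨
    count χ c (p + p)                                   ∎)
    where
    open ≤-Reasoning
    c = s + (u + k)
    j = p ∸ k
    j+k≡p : j + k ≡ p
    j+k≡p = m∸n+n≡m k≤p
    s+n≡c+p : s + n ≡ c + p
    s+n≡c+p = trans (cong (s +_) n≡) (regroup s u k p)
      where
      regroup : ∀ s u k p → s + (p + (u + k)) ≡ s + (u + k) + p
      regroup = solve-∀
    c+j≡s+p+u : c + j ≡ s + p + u
    c+j≡s+p+u = trans (regroup s u k j) (cong (λ y → s + y + u) j+k≡p)
      where
      regroup : ∀ s u k j → s + (u + k) + j ≡ s + (j + k) + u
      regroup = solve-∀
    tail≤ : count χ (s + p + u) k ≤ count χ c p
    tail≤ = begin
      count χ (s + p + u) k              ≡⟨ cong (λ y → count χ y k) c+j≡s+p+u ⟨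
      count χ (c + j) k                  ≤⟨ m≤n+m _ _ ⟩
      count χ c j + count χ (c + j) k    ≡⟨ count-+ χ c j k ⟨
      count χ c (j + k)                  ≡⟨ cong (count χ c) j+k≡p ⟩
      count χ c p                        ∎

  -- Around the cycle from s: s, then p - 1 + u vertices whose first and last u are not in S,
  -- then s + p + u, then p - 1 + B vertices whose first and last B are not in S.
  few-in-S : ∀ p s u B → 2 ≤ p → 0 < u → 0 < B → n ≡ p + (u + p + B) → p ≤ u + B →
    count χ (suc s) u ≡ 0 → count χ (s + p) u ≡ 0 →
    count χ (suc (s + p + u)) B ≡ 0 → count χ (s + p + u + p) B ≡ 0 → ∣ S ∣ ≤ p
  few-in-S (suc (suc q)) s (suc u′) (suc B′) (s≤s (s≤s z≤n)) (s≤s z≤n) (s≤s z≤n) n≡ p≤u+B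
           early-u late-u early-B late-B = begin
    ∣ S ∣                                              ≡⟨ ∣∣≡count n S s ⟩
    count χ s n                                        ≡⟨ cong (count χ s) (trans n≡ (regroup-n q u′ B′)) ⟩
    bit (χ s) + count χ (suc s) (A + suc C)            ≡⟨ cong (bit (χ s) +_) (count-+ χ (suc s) A (suc C)) ⟩
    bit (χ s) + (X + (bit (χ (suc s + A)) + Y))        ≤⟨ +-mono-≤ (bit≤1 (χ s)) (+-monoʳ-≤ X (+-monoˡ-≤ Y (bit≤1 (χ (suc s + A))))) ⟩
    suc (X + suc Y)                                    ≤⟨ s≤s (+-mono-≤ X≤ (s≤s Y≤)) ⟩
    suc ((q ∸ u′) + suc (q ∸ B′))                      ≡⟨ cong suc (+-suc (q ∸ u′) (q ∸ B′)) ⟩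
    suc (suc ((q ∸ u′) + (q ∸ B′)))                    ≤⟨ s≤s (s≤s (∸+∸≤ q u′ B′ q≤u′+B′)) ⟩
    suc (suc q)                                        ∎
    where
    open ≤-Reasoning
    A = suc q + suc u′
    C = suc q + suc B′
    X = count χ (suc s) A
    Y = count χ (suc (suc s + A)) C
    regroup-n : ∀ q u B → suc (suc q) + (suc u + suc (suc q) + suc B) ≡ suc ((suc q + suc u) + suc (suc q + suc B))
    regroup-n = solve-∀
    q≤u′+B′ : q ≤ u′ + B′
    q≤u′+B′ = s≤s⁻¹ (subst (suc q ≤_) (+-suc u′ B′) (s≤s⁻¹ p≤u+B))
    X≤ : X ≤ q ∸ u′
    X≤ = count-empty-ends χ (suc s) (suc u′) (suc q) (suc u′) early-u
      (subst (λ c → count χ c (suc u′) ≡ 0) (+-suc s (suc q)) late-u)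
    Y≤ : Y ≤ q ∸ B′
    Y≤ = count-empty-ends χ (suc (suc s + A)) (suc B′) (suc q) (suc B′)
      (subst (λ c → count χ c (suc B′) ≡ 0) (cong suc (regroup₁ s q u′)) early-B)
      (subst (λ c → count χ c (suc B′) ≡ 0) (regroup₂ s q u′) late-B)
      where
      regroup₁ : ∀ s q u → s + suc (suc q) + suc u ≡ suc s + (suc q + suc u)
      regroup₁ = solve-∀
      regroup₂ : ∀ s q u → s + suc (suc q) + suc u + suc (suc q) ≡ suc (suc s + (suc q + suc u)) + suc q
      regroup₂ = solve-∀

  triple-from-short-gap : ∀ p s u B → 2 ≤ p → 0 < u → 0 < B → n ≡ p + (u + p + B) → p ≤ u + B → p < ∣ S ∣ →
    InS s → InS (s + p + u) → count χ (s + p) u ≡ 0 → Triple p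
  triple-from-short-gap p s u B 2≤p 0<u 0<B n≡ p≤u+B p<∣S∣ s∈S s+p+u∈S late-u
    with first-true-or-none χ (s + p + u + p) B | first-true-or-none χ (suc s) u
       | first-true-or-none χ (suc (s + p + u)) B
  ... | inj₁ (z , z<B , z∈S , _) | _ | _ =
    s , p + u , p + z , m≤m+n p u , m≤m+n p z , lt , s∈S ,
    subst InS (+-assoc s p u) s+p+u∈S , subst InS (regroup s p u z) z∈S
    where
    open ≤-Reasoning
    regroup : ∀ s p u z → s + p + u + p + z ≡ s + (p + u) + (p + z)
    regroup = solve-∀
    regroup-lt : ∀ p u z → p + u + (p + z) ≡ p + (u + p + z)
    regroup-lt = solve-∀
    lt : p + u + (p + z) < n
    lt = begin-strict
      p + u + (p + z)       ≡⟨ regroup-lt p u z ⟩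
      p + (u + p + z)       <⟨ +-monoʳ-< p (+-monoʳ-< (u + p) z<B) ⟩
      p + (u + p + B)       ≡⟨ n≡ ⟨
      n                     ∎
  ... | inj₂ _ | inj₁ (x , x<u , x∈S , _) | _ =
    suc s + x , p + t , p + B , m≤m+n p t , m≤m+n p B , lt , x∈S ,
    subst InS (trans (cong (λ v → s + p + v) (sym x+t≡u)) (regroup₁ s p x t)) s+p+u∈S ,
    subst InS (trans (cong (s +_) n≡) (trans (cong (λ v → s + (p + (v + p + B))) (sym x+t≡u)) (regroup₂ s p x t B)))
      (InS-+n s∈S)
    where
    open ≤-Reasoning
    t = u ∸ suc x
    x+t≡u : suc x + t ≡ u
    x+t≡u = m+[n∸m]≡n x<u
    regroup₁ : ∀ s p x t → s + p + (suc x + t) ≡ suc s + x + (p + t)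
    regroup₁ = solve-∀
    regroup₂ : ∀ s p x t B → s + (p + ((suc x + t) + p + B)) ≡ suc s + x + (p + t) + (p + B)
    regroup₂ = solve-∀
    regroup-lt : ∀ p t B → p + t + (p + B) ≡ p + (t + p + B)
    regroup-lt = solve-∀
    lt : p + t + (p + B) < n
    lt = begin-strict
      p + t + (p + B)       ≡⟨ regroup-lt p t B ⟩
      p + (t + p + B)       <⟨ +-monoʳ-< p (+-monoˡ-< B (+-monoˡ-< p (subst (t <_) x+t≡u (s≤s (m≤n+m t x))))) ⟩
      p + (u + p + B)       ≡⟨ n≡ ⟨
      n                     ∎
  ... | inj₂ _ | inj₂ _ | inj₁ (y , y<B , y∈S , _) =
    suc (s + p + u) + y , p + t , p + u , m≤m+n p t , m≤m+n p u , lt , y∈S ,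
    subst InS (trans (cong (s +_) n≡) (trans (cong (λ v → s + (p + (u + p + v))) (sym y+t≡B)) (regroup₁ s p u y t)))
      (InS-+n s∈S) ,
    subst InS (trans (cong (s + p + u +_) n≡) (trans (cong (λ v → s + p + u + (p + (u + p + v))) (sym y+t≡B))
      (regroup₂ s p u y t))) (InS-+n s+p+u∈S)
    where
    open ≤-Reasoning
    t = B ∸ suc y
    y+t≡B : suc y + t ≡ B
    y+t≡B = m+[n∸m]≡n y<B
    regroup₁ : ∀ s p u y t → s + (p + (u + p + (suc y + t))) ≡ suc (s + p + u) + y + (p + t)
    regroup₁ = solve-∀
    regroup₂ : ∀ s p u y t → s + p + u + (p + (u + p + (suc y + t))) ≡ suc (s + p + u) + y + (p + t) + (p + u)
    regroup₂ = solve-∀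
    regroup-lt : ∀ p t u → p + t + (p + u) ≡ p + (u + p + t)
    regroup-lt = solve-∀
    lt : p + t + (p + u) < n
    lt = begin-strict
      p + t + (p + u)       ≡⟨ regroup-lt p t u ⟩
      p + (u + p + t)       <⟨ +-monoʳ-< p (+-monoʳ-< (u + p) (subst (t <_) y+t≡B (s≤s (m≤n+m t y)))) ⟩
      p + (u + p + B)       ≡⟨ n≡ ⟨
      n                     ∎
  ... | inj₂ late-B | inj₂ early-u | inj₂ early-B =
    ⊥-elim (<⇒≱ p<∣S∣ (few-in-S p s u B 2≤p 0<u 0<B n≡ p≤u+B early-u late-u early-B late-B))

  pair-or-triple : ∀ p → 2 ≤ p → 3 * p ≤ n → p < ∣ S ∣ → ∀ s → InS s → Pair p ⊎ Triple p
  pair-or-triple p 2≤p 3p≤n p<∣S∣ s s∈S with first-true-or-none χ (s + p) (n ∸ p)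
  ... | inj₂ none = ⊥-elim (<⇒≱ p<∣S∣ (begin
    ∣ S ∣                                      ≡⟨ ∣∣≡count n S s ⟩
    count χ s n                                ≡⟨ cong (count χ s) p+[n∸p]≡n ⟨
    count χ s (p + (n ∸ p))                    ≡⟨ count-+ χ s p (n ∸ p) ⟩
    count χ s p + count χ (s + p) (n ∸ p)      ≡⟨ cong (count χ s p +_) none ⟩
    count χ s p + 0                            ≡⟨ +-identityʳ _ ⟩
    count χ s p                                ≤⟨ count≤ χ s p ⟩
    p                                          ∎))
    where
    open ≤-Reasoning
    p+[n∸p]≡n : p + (n ∸ p) ≡ n
    p+[n∸p]≡n = m+[n∸m]≡n (≤-trans (m≤m+n p (2 * p)) 3p≤n)
  ... | inj₁ (zero , _ , s+p∈S , _) = inj₁ (s , s∈S , subst InS (+-identityʳ (s + p)) s+p∈S)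
  ... | inj₁ (suc u′ , u<n∸p , s+p+u∈S , gap) with suc u′ + p <? n ∸ p
  ...   | yes short = inj₂ (triple-from-short-gap p s u B 2≤p z<s (m<n⇒0<n∸m short) n≡ p≤u+B p<∣S∣ s∈S s+p+u∈S gap)
    where
    open ≤-Reasoning
    u = suc u′
    B = n ∸ p ∸ (u + p)
    n≡ : n ≡ p + (u + p + B)
    n≡ = trans (sym (m+[n∸m]≡n (≤-trans (m≤m+n p (2 * p)) 3p≤n))) (cong (p +_) (sym (m+[n∸m]≡n (<⇒≤ short))))
    regroup₁ : ∀ p → 3 * p ≡ p + p + p
    regroup₁ = solve-∀
    regroup₂ : ∀ p u B → p + (u + p + B) ≡ p + p + (u + B)
    regroup₂ = solve-∀
    p≤u+B : p ≤ u + B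
    p≤u+B = +-cancelˡ-≤ (p + p) p (u + B) (begin
      p + p + p              ≡⟨ regroup₁ p ⟨
      3 * p                  ≤⟨ 3p≤n ⟩
      n                      ≡⟨ n≡ ⟩
      p + (u + p + B)        ≡⟨ regroup₂ p u B ⟩
      p + p + (u + B)        ∎)
  ...   | no long = inj₁ (pair-from-long-gap p s u k n≡ k≤p gap p<∣S∣)
    where
    u = suc u′
    k = n ∸ p ∸ u
    n≡ : n ≡ p + (u + k)
    n≡ = trans (sym (m+[n∸m]≡n (≤-trans (m≤m+n p (2 * p)) 3p≤n))) (cong (p +_) (sym (m+[n∸m]≡n (<⇒≤ u<n∸p))))
    k≤p : k ≤ p
    k≤p = m≤n+o⇒m∸n≤o (n ∸ p) u (≮⇒≥ long)

paths-exist : ∀ n .{{_ : NonZero n}} p → 2 ≤ p → 3 * p ≤ n → (S T : Subset n) →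
  p < ∣ S ∣ → 2 * p + 2 ≤ ∣ T ∣ → PathPair n p S T
paths-exist n p 2≤p 3p≤n S T p<∣S∣ 2p+2≤∣T∣ with first-true-or-none (member n S) 0 n
... | inj₂ none = ⊥-elim (<⇒≱ p<∣S∣ (≤-trans (≤-reflexive (trans (∣∣≡count n S 0) none)) z≤n))
... | inj₁ (s , _ , s∈S , _) =
  paths-from-split n ([ split-from-pair n S p T hT p<n , split-from-triple n S p T hT ]′
    (pair-or-triple n S p 2≤p 3p≤n p<∣S∣ s s∈S))
  where
  regroup : ∀ p → 2 * p + 2 ≡ suc p + suc p
  regroup = solve-∀
  hT : suc p + suc p ≤ ∣ T ∣
  hT = subst (_≤ ∣ T ∣) (regroup p) 2p+2≤∣T∣
  p<n : p < n
  p<n = <-≤-trans (m<m+n p (≤-trans (≤-trans (s≤s z≤n) 2≤p) (m≤m+n p (p + 0)))) 3p≤n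

lemma2 : (n : ℕ) .{{_ : NonZero n}} → 6 ≤ n →
    (S T : Subset n) →
    suc (n / 3) ≤ ∣ S ∣ → 2 * (n / 3) + 2 ≤ ∣ T ∣ →
    ∃₂ λ (P Q : CPath n) →
      Disjoint P Q × EndsIn P S × EndsIn Q T ×
      suc (n / 3) ≤ len P × suc (n / 3) ≤ len Q
lemma2 n 6≤n = paths-exist n (n / 3) (/-monoˡ-≤ 3 6≤n) (subst (_≤ n) (*-comm (n / 3) 3) (m/n*n≤m n 3))
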